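{- Let $r \geq 1$ and $d \geq 1$ be integers, and let $G$ be a graph on $n$ vertices satisfying the $(r+d+1)$-strong neighbourhood property. Let $\Delta$ denote the maximum degree of a vertex in $G$, and assume $\Delta \geq 2$. Let $\theta_n = \theta_n(G,r,d)$ be the minimum size of an identification code of $G$ with index $r$. Then \[ \frac{1}{\Delta+1} \leq \frac{\theta_n}{n} \leq 1-\frac{c(d,r)}{(\Delta+1)^{(r+2)/d}}, \qquad\text{where } c(d,r) := d\,(d+1)^{ -1-1/d}\,(2r)^{ -1/d}. \]
   Context: All graphs are finite and simple, with vertex set $V=\{1,\dots,n\}$. For a vertex $v$, $N(v)$ is the set of vertices adjacent to $v$ (not including $v$), and $N[v] = N(v)\cup\{v\}$. For a set $A$, $\#A$ denotes its cardinality. A set of vertices $\mathcal{C}$ is an identification code for $G$ with index $r$ if for any two distinct vertices $u,v$ of $G$, $\#\big((N[v]\setminus N[u])\cap \mathcal{C}\big) \geq r$. For an integer $k\ge 1$, $G$ has the $k$-strong neighbourhood property if for any two distinct vertices $u,v$ of $G$, $\#\big(N[v]\setminus N[u]\big) \geq k$. -}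

module Defs where

open import Data.Nat using (ℕ; _⊔_)
import Data.Nat
import Data.Product
open import Data.Bool using (Bool; true; false; _∨_)
open import Data.Fin using (Fin; _≟_)
open import Data.Fin.Subset using (Subset; ∣_∣; _─_; _∩_)
open import Data.Vec using (tabulate; foldr′)
open import Relation.Binary.PropositionalEquality using (_≡_; _≢_)
open import Relation.Nullary.Decidable using (⌊_⌋)

record Graph (n : ℕ) : Set where
  field
    adj       : Fin n → Fin n → Bool
    adj-sym   : ∀ u v → adj u v ≡ adj v u
    adj-irrefl : ∀ v → adj v v ≡ false
open Graph public

module _ {n : ℕ} (G : Graph n) where

  N : Fin n → Subset n
  N v = tabulate (λ u → adj G v u)

  N[_] : Fin n → Subset n
  N[ v ] = tabulate (λ u → ⌊ u ≟ v ⌋ ∨ adj G v u)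

  degree : Fin n → ℕ
  degree v = ∣ N v ∣

  maxDegree : ℕ
  maxDegree = foldr′ _⊔_ 0 (tabulate degree)

  IsIdCode : ℕ → Subset n → Set
  IsIdCode r C = ∀ u v → u ≢ v → r Data.Nat.≤ ∣ (N[ v ] ─ N[ u ]) ∩ C ∣

  StrongNbhd : ℕ → Set
  StrongNbhd k = ∀ u v → u ≢ v → k Data.Nat.≤ ∣ N[ v ] ─ N[ u ] ∣

  IsMinCodeSize : ℕ → ℕ → Set
  IsMinCodeSize r θ =
    Data.Product.Σ (Subset n) (λ C → IsIdCode r C Data.Product.× ∣ C ∣ ≡ θ)
    Data.Product.× (∀ C → IsIdCode r C → θ Data.Nat.≤ ∣ C ∣)

{-# OPTIONS --safe #-}
-- Lower bound: every closed neighbourhood N[v] meets a code (for u ≠ v, N[v] ∖ N[u] contains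
-- r ≥ 1 code vertices), and a code vertex lies in at most Δ + 1 closed neighbourhoods.
--
-- Upper bound, by the probabilistic method: put every vertex into ω independently with
-- probability p. Call v bad if some u ≠ v has at most t = r − 1 vertices of N[v] ∖ N[u] outside ω,
-- and take as code the complement of the vertices of ω that lie in no N[v] with v bad. It has
-- index r: for bad v all of N[v] ∖ N[u] is in the code, otherwise at least r of its vertices
-- lie outside ω. Since |N[v] ∖ N[u]| ≥ r + d + 1, each such event has probability at most
-- (Δ + 1)^t p^(d+2), and per v at most 1 + (Δ + 1)² of them are distinct, because N[v] ∖ N[u] = N[v]
-- when N[u] misses N[v]. So some ω removes n p − n (Δ + 1)^r (1 + (Δ + 1)²) p^(d+2) vertices or
-- more, and p^d ≈ 1/(2r (d + 1) (Δ + 1)^(r+2)) gives the bound.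

module Submission where

open import Defs
open import Data.Bool using (Bool; true; false; _∧_; _∨_; not; T)
open import Data.Bool.Properties using (∧-comm; ∧-zeroʳ; ∧-identityʳ)
open import Data.Empty using (⊥-elim)
open import Data.Fin using (Fin; zero; suc; _≟_)
open import Data.Fin.Subset using (Subset; ∣_∣; _─_; _∩_; ∁; ⁅_⁆; _∉_)
open import Data.Fin.Subset.Properties
  using (p⊆q⇒∣p∣≤∣q∣; p⊂q⇒∣p∣<∣q∣; ⊆⊤; ∈⊤; ∣⊤∣≡n; x∈⁅x⁆; ∣⁅x⁆∣≡1; ∣p─q∣≤∣p∣; ∣∁p∣≡n∸∣p∣; ∣p∣≤n)
open import Data.Nat hiding (_≟_)
open import Data.Nat.Combinatorics using (_C_; nCk+nC[k+1]≡[n+1]C[k+1]; nCk≡nC[n∸k])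
open import Data.Nat.Properties hiding (_≟_)
open import Algebra.Properties.Semiring.Sum +-*-semiring
  using (sum-syntax; sum-cong-≗; ∑-comm; *-distribˡ-sum; *-distribʳ-sum)
open import Data.Nat.Tactic.RingSolver using (solve-∀)
open import Data.Product using (∃; ∃₂; _×_; _,_; proj₁; proj₂)
open import Data.Sum using (_⊎_; inj₁; inj₂)
open import Data.Unit using (tt)
open import Data.Vec using ([]; _∷_; lookup; tabulate; foldr′)
open import Data.Vec.Properties
  using ([]=⇒lookup; lookup⇒[]=; lookup-zipWith; lookup-map; lookup∘tabulate)
open import Function using (_∘_)
open import Relation.Binary.PropositionalEquality
open import Relation.Nullary using (¬_; yes; no; contradiction)
open import Relation.Nullary.Decidable using (⌊_⌋; dec-true; dec-false; isYes≗does)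
open import Relation.Unary using (Decidable)

𝟙 : Bool → ℕ
𝟙 true = 1
𝟙 false = 0

𝟙-∧≤ʳ : ∀ a b → 𝟙 (a ∧ b) ≤ 𝟙 b
𝟙-∧≤ʳ true b = ≤-refl
𝟙-∧≤ʳ false b = z≤n

∧≡true⁻ : ∀ {a b} → a ∧ b ≡ true → a ≡ true × b ≡ true
∧≡true⁻ {true} b≡true = refl , b≡true

≤ᵇ-suc : ∀ m n → (suc m ≤ᵇ suc n) ≡ (m ≤ᵇ n)
≤ᵇ-suc zero n = refl
≤ᵇ-suc (suc m) n = refl

≤ᵇ≡true⇒≤ : ∀ {m n} → (m ≤ᵇ n) ≡ true → m ≤ n
≤ᵇ≡true⇒≤ {m} {n} eq = ≤ᵇ⇒≤ m n (subst T (sym eq) tt)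

≤ᵇ≡false⇒> : ∀ {m n} → (m ≤ᵇ n) ≡ false → n < m
≤ᵇ≡false⇒> eq = ≰⇒> λ m≤n → subst T eq (≤⇒≤ᵇ m≤n)

𝟙-≤ᵇ-mono : ∀ {a b c d} → (a ≤ b → c ≤ d) → 𝟙 (a ≤ᵇ b) ≤ 𝟙 (c ≤ᵇ d)
𝟙-≤ᵇ-mono {a} {b} {c} {d} a≤b⇒c≤d with a ≤ᵇ b in eq
... | false = z≤n
... | true with c ≤ᵇ d in eq′
... | true = ≤-refl
... | false = contradiction (a≤b⇒c≤d (≤ᵇ≡true⇒≤ eq)) (<⇒≱ (≤ᵇ≡false⇒> eq′))

𝟙[1≤ᵇm]≤m : ∀ m → 𝟙 (1 ≤ᵇ m) ≤ m
𝟙[1≤ᵇm]≤m zero = z≤n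
𝟙[1≤ᵇm]≤m (suc m) = s≤s z≤n

⌊≟⌋-refl : ∀ {n} (v : Fin n) → ⌊ v ≟ v ⌋ ≡ true
⌊≟⌋-refl v = trans (isYes≗does (v ≟ v)) (dec-true (v ≟ v) refl)

⌊≟⌋-≢ : ∀ {n} {u v : Fin n} → u ≢ v → ⌊ u ≟ v ⌋ ≡ false
⌊≟⌋-≢ {u = u} {v} u≢v = trans (isYes≗does (u ≟ v)) (dec-false (u ≟ v) u≢v)

∑-mono-≤ : ∀ {n} {f g : Fin n → ℕ} → (∀ i → f i ≤ g i) → ∑[ i < n ] f i ≤ ∑[ i < n ] g i
∑-mono-≤ {zero} f≤g = z≤n
∑-mono-≤ {suc n} f≤g = +-mono-≤ (f≤g zero) (∑-mono-≤ (f≤g ∘ suc))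

∑-const : ∀ n c → ∑[ i < n ] c ≡ n * c
∑-const zero c = refl
∑-const (suc n) c = cong (c +_) (∑-const n c)

f≤∑f : ∀ {n} (f : Fin n → ℕ) i → f i ≤ ∑[ j < n ] f j
f≤∑f f zero = m≤m+n (f zero) _
f≤∑f f (suc i) = ≤-trans (f≤∑f (f ∘ suc) i) (m≤n+m _ (f zero))

any : ∀ {n} → (Fin n → Bool) → Bool
any {zero} f = false
any {suc n} f = f zero ∨ any (f ∘ suc)

any-witness : ∀ {n} (f : Fin n → Bool) → any f ≡ true → ∃ λ i → f i ≡ true
any-witness {suc n} f h with f zero in eq
... | true = zero , eq
... | false with any-witness (f ∘ suc) h
... | i , fi = suc i , fi

any-intro : ∀ {n} (f : Fin n → Bool) i → f i ≡ true → any f ≡ true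
any-intro f zero fi rewrite fi = refl
any-intro f (suc i) fi rewrite any-intro (f ∘ suc) i fi with f zero
... | true = refl
... | false = refl

any-false : ∀ {n} (f : Fin n → Bool) → any f ≡ false → ∀ i → f i ≡ false
any-false f any≡false i with f i in fi
... | false = refl
... | true = contradiction (trans (sym (any-intro f i fi)) any≡false) λ ()

𝟙-any≤∑ : ∀ {n} (f : Fin n → Bool) → 𝟙 (any f) ≤ ∑[ i < n ] 𝟙 (f i)
𝟙-any≤∑ {zero} f = z≤n
𝟙-any≤∑ {suc n} f with f zero
... | true = s≤s z≤n
... | false = 𝟙-any≤∑ (f ∘ suc)

_∈ᵇ_ : ∀ {n} → Fin n → Subset n → Bool
x ∈ᵇ p = lookup p x

∈ᵇ-∩ : ∀ {n} (p q : Subset n) x → x ∈ᵇ (p ∩ q) ≡ (x ∈ᵇ p ∧ x ∈ᵇ q)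
∈ᵇ-∩ p q x = lookup-zipWith _∧_ x p q

∈ᵇ-∁ : ∀ {n} (p : Subset n) x → x ∈ᵇ ∁ p ≡ not (x ∈ᵇ p)
∈ᵇ-∁ p x = lookup-map x not p

∈ᵇ-─ : ∀ {n} (p q : Subset n) x → x ∈ᵇ (p ─ q) ≡ (x ∈ᵇ p ∧ not (x ∈ᵇ q))
∈ᵇ-─ (b ∷ p) (true ∷ q) zero = sym (∧-zeroʳ b)
∈ᵇ-─ (b ∷ p) (false ∷ q) zero = sym (∧-identityʳ b)
∈ᵇ-─ (b ∷ p) (c ∷ q) (suc x) = ∈ᵇ-─ p q x

∈ᵇ-∩⁺ : ∀ {n} (p q : Subset n) x → x ∈ᵇ p ≡ true → x ∈ᵇ q ≡ true → x ∈ᵇ (p ∩ q) ≡ true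
∈ᵇ-∩⁺ p q x x∈p x∈q rewrite ∈ᵇ-∩ p q x | x∈p | x∈q = refl

∈ᵇ-─⁻ : ∀ {n} (p q : Subset n) x → x ∈ᵇ (p ─ q) ≡ true → x ∈ᵇ p ≡ true × x ∈ᵇ q ≡ false
∈ᵇ-─⁻ p q x x∈p─q rewrite ∈ᵇ-─ p q x with x ∈ᵇ p | x ∈ᵇ q
... | true | false = refl , refl
... | true | true = contradiction x∈p─q λ ()
... | false | _ = contradiction x∈p─q λ ()

∈ᵇ-∁-─ : ∀ {n} (p q : Subset n) x → x ∈ᵇ p ≡ false ⊎ x ∈ᵇ q ≡ true → x ∈ᵇ ∁ (p ─ q) ≡ true
∈ᵇ-∁-─ p q x x∉p⊎x∈q rewrite ∈ᵇ-∁ (p ─ q) x | ∈ᵇ-─ p q x with x∉p⊎x∈q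
... | inj₁ x∉p rewrite x∉p = refl
... | inj₂ x∈q rewrite x∈q = cong not (∧-zeroʳ (x ∈ᵇ p))

∣p∣≡∑𝟙 : ∀ {n} (p : Subset n) → ∣ p ∣ ≡ ∑[ x < n ] 𝟙 (x ∈ᵇ p)
∣p∣≡∑𝟙 [] = refl
∣p∣≡∑𝟙 (true ∷ p) = cong suc (∣p∣≡∑𝟙 p)
∣p∣≡∑𝟙 (false ∷ p) = ∣p∣≡∑𝟙 p

∑-𝟙∧ : ∀ {n} b (p : Subset n) → ∑[ x < n ] 𝟙 (b ∧ x ∈ᵇ p) ≡ 𝟙 b * ∣ p ∣
∑-𝟙∧ true p = trans (sym (∣p∣≡∑𝟙 p)) (sym (*-identityˡ ∣ p ∣))
∑-𝟙∧ {n} false p = trans (∑-const n 0) (*-zeroʳ n)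

∣∣-mono : ∀ {n} (p q : Subset n) → (∀ x → x ∈ᵇ p ≡ true → x ∈ᵇ q ≡ true) → ∣ p ∣ ≤ ∣ q ∣
∣∣-mono p q p⊆q = p⊆q⇒∣p∣≤∣q∣ {p = p} λ {x} x∈p → lookup⇒[]= x q (p⊆q x ([]=⇒lookup x∈p))

∣p∣≤∣p─q∣+∣q∣ : ∀ {n} (p q : Subset n) → ∣ p ∣ ≤ ∣ p ─ q ∣ + ∣ q ∣
∣p∣≤∣p─q∣+∣q∣ [] [] = z≤n
∣p∣≤∣p─q∣+∣q∣ (true ∷ p) (true ∷ q) = ≤-trans (s≤s (∣p∣≤∣p─q∣+∣q∣ p q)) (≤-reflexive (sym (+-suc _ _)))
∣p∣≤∣p─q∣+∣q∣ (true ∷ p) (false ∷ q) = s≤s (∣p∣≤∣p─q∣+∣q∣ p q)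
∣p∣≤∣p─q∣+∣q∣ (false ∷ p) (true ∷ q) = ≤-trans (∣p∣≤∣p─q∣+∣q∣ p q) (+-monoʳ-≤ _ (n≤1+n _))
∣p∣≤∣p─q∣+∣q∣ (false ∷ p) (false ∷ q) = ∣p∣≤∣p─q∣+∣q∣ p q

∣p─q∣+∣p∩q∣≡∣p∣ : ∀ {n} (p q : Subset n) → ∣ p ─ q ∣ + ∣ p ∩ q ∣ ≡ ∣ p ∣
∣p─q∣+∣p∩q∣≡∣p∣ [] [] = refl
∣p─q∣+∣p∩q∣≡∣p∣ (true ∷ p) (true ∷ q) = trans (+-suc _ _) (cong suc (∣p─q∣+∣p∩q∣≡∣p∣ p q))
∣p─q∣+∣p∩q∣≡∣p∣ (true ∷ p) (false ∷ q) = cong suc (∣p─q∣+∣p∩q∣≡∣p∣ p q)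
∣p─q∣+∣p∩q∣≡∣p∣ (false ∷ p) (true ∷ q) = ∣p─q∣+∣p∩q∣≡∣p∣ p q
∣p─q∣+∣p∩q∣≡∣p∣ (false ∷ p) (false ∷ q) = ∣p─q∣+∣p∩q∣≡∣p∣ p q

∣p∩q∣≡0⇒p─q≡p : ∀ {n} (p q : Subset n) → ∣ p ∩ q ∣ ≡ 0 → p ─ q ≡ p
∣p∩q∣≡0⇒p─q≡p [] [] _ = refl
∣p∩q∣≡0⇒p─q≡p (true ∷ p) (false ∷ q) eq = cong (true ∷_) (∣p∩q∣≡0⇒p─q≡p p q eq)
∣p∩q∣≡0⇒p─q≡p (false ∷ p) (true ∷ q) eq = cong (false ∷_) (∣p∩q∣≡0⇒p─q≡p p q eq)
∣p∩q∣≡0⇒p─q≡p (false ∷ p) (false ∷ q) eq = cong (false ∷_) (∣p∩q∣≡0⇒p─q≡p p q eq)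

nCk≤n^k : ∀ n k → n C k ≤ n ^ k
nCk≤n^k n zero = ≤-refl
nCk≤n^k zero (suc k) = z≤n
nCk≤n^k (suc n) (suc k) = begin
  suc n C suc k           ≡⟨ nCk+nC[k+1]≡[n+1]C[k+1] n k ⟨
  n C k + n C suc k       ≤⟨ +-mono-≤ (nCk≤n^k n k) (nCk≤n^k n (suc k)) ⟩
  n ^ k + n * n ^ k       ≡⟨⟩
  suc n * n ^ k           ≤⟨ *-monoʳ-≤ (suc n) (^-monoˡ-≤ k (n≤1+n n)) ⟩
  suc n * suc n ^ k       ∎
  where open ≤-Reasoning

-- 𝔼 n f = Σ_ω j^|ω| k^(n−|ω|) f ω is (j + k)^n times the mean of f when every vertex lies in ω
-- independently with probability p = j/(j + k).
module BernoulliSum (j k : ℕ) where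

  Q : ℕ
  Q = j + k

  𝔼 : ∀ n → (Subset n → ℕ) → ℕ
  𝔼 zero f = f []
  𝔼 (suc n) f = j * 𝔼 n (f ∘ (true ∷_)) + k * 𝔼 n (f ∘ (false ∷_))

  𝔼-mono : ∀ n {f g : Subset n → ℕ} → (∀ ω → f ω ≤ g ω) → 𝔼 n f ≤ 𝔼 n g
  𝔼-mono zero f≤g = f≤g []
  𝔼-mono (suc n) f≤g = +-mono-≤ (*-monoʳ-≤ j (𝔼-mono n (f≤g ∘ (true ∷_))))
                                (*-monoʳ-≤ k (𝔼-mono n (f≤g ∘ (false ∷_))))

  𝔼-cong : ∀ n {f g : Subset n → ℕ} → (∀ ω → f ω ≡ g ω) → 𝔼 n f ≡ 𝔼 n g
  𝔼-cong n f≡g = ≤-antisym (𝔼-mono n (≤-reflexive ∘ f≡g)) (𝔼-mono n (≤-reflexive ∘ sym ∘ f≡g))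

  𝔼-+ : ∀ n (f g : Subset n → ℕ) → 𝔼 n (λ ω → f ω + g ω) ≡ 𝔼 n f + 𝔼 n g
  𝔼-+ zero f g = refl
  𝔼-+ (suc n) f g
    rewrite 𝔼-+ n (f ∘ (true ∷_)) (g ∘ (true ∷_)) | 𝔼-+ n (f ∘ (false ∷_)) (g ∘ (false ∷_)) =
    lemma j k _ _ _ _
    where
    lemma : ∀ j k a b c d → j * (a + b) + k * (c + d) ≡ j * a + k * c + (j * b + k * d)
    lemma = solve-∀

  𝔼-*ˡ : ∀ n c (f : Subset n → ℕ) → 𝔼 n (λ ω → c * f ω) ≡ c * 𝔼 n f
  𝔼-*ˡ zero c f = refl
  𝔼-*ˡ (suc n) c f rewrite 𝔼-*ˡ n c (f ∘ (true ∷_)) | 𝔼-*ˡ n c (f ∘ (false ∷_)) =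
    lemma j k c _ _
    where
    lemma : ∀ j k c a b → j * (c * a) + k * (c * b) ≡ c * (j * a + k * b)
    lemma = solve-∀

  𝔼-const : ∀ n c → 𝔼 n (λ _ → c) ≡ c * Q ^ n
  𝔼-const zero c = sym (*-identityʳ c)
  𝔼-const (suc n) c rewrite 𝔼-const n c = lemma j k c (Q ^ n)
    where
    lemma : ∀ j k c x → j * (c * x) + k * (c * x) ≡ c * ((j + k) * x)
    lemma = solve-∀

  𝔼-∑ : ∀ n {m} (f : Fin m → Subset n → ℕ) → 𝔼 n (λ ω → ∑[ i < m ] f i ω) ≡ ∑[ i < m ] 𝔼 n (f i)
  𝔼-∑ n {zero} f = 𝔼-const n 0
  𝔼-∑ n {suc m} f = trans (𝔼-+ n (f zero) _) (cong (𝔼 n (f zero) +_) (𝔼-∑ n (f ∘ suc)))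

  𝔼-∣∣ : ∀ n → Q * 𝔼 n ∣_∣ ≡ n * j * Q ^ n
  𝔼-∣∣ zero = *-zeroʳ Q
  𝔼-∣∣ (suc n) = begin
    Q * (j * 𝔼 n (suc ∘ ∣_∣) + k * 𝔼 n ∣_∣)     ≡⟨ cong (λ x → Q * (j * x + k * 𝔼 n ∣_∣)) (𝔼-+ n (λ _ → 1) ∣_∣) ⟩
    Q * (j * (𝔼 n (λ _ → 1) + 𝔼 n ∣_∣) + k * 𝔼 n ∣_∣)
                                              ≡⟨ cong (λ x → Q * (j * (x + 𝔼 n ∣_∣) + k * 𝔼 n ∣_∣)) (𝔼-const n 1) ⟩
    Q * (j * (1 * Q ^ n + 𝔼 n ∣_∣) + k * 𝔼 n ∣_∣)  ≡⟨ lemma₁ j k (Q ^ n) (𝔼 n ∣_∣) ⟩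
    j * Q * Q ^ n + Q * (Q * 𝔼 n ∣_∣)           ≡⟨ cong (λ x → j * Q * Q ^ n + Q * x) (𝔼-∣∣ n) ⟩
    j * Q * Q ^ n + Q * (n * j * Q ^ n)          ≡⟨ lemma₂ j Q n (Q ^ n) ⟩
    suc n * j * Q ^ suc n                        ∎
    where
    open ≡-Reasoning
    lemma₁ : ∀ j k x w → (j + k) * (j * (1 * x + w) + k * w) ≡ j * (j + k) * x + (j + k) * ((j + k) * w)
    lemma₁ = solve-∀
    lemma₂ : ∀ j Q n x → j * Q * x + Q * (n * j * x) ≡ (1 + n) * j * (Q * x)
    lemma₂ = solve-∀

  weighted-≤ : ∀ {a b c} x → a ≤ x * c → b ≤ x * c → j * a + k * b ≤ Q * x * c
  weighted-≤ {a} {b} {c} x a≤ b≤ = begin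
    j * a + k * b                ≤⟨ +-mono-≤ (*-monoʳ-≤ j a≤) (*-monoʳ-≤ k b≤) ⟩
    j * (x * c) + k * (x * c)    ≡⟨ lemma j k x c ⟩
    (j + k) * x * c              ∎
    where
    open ≤-Reasoning
    lemma : ∀ j k x y → j * (x * y) + k * (x * y) ≡ (j + k) * x * y
    lemma = solve-∀

  ∃≥𝔼 : ∀ n (f : Subset n → ℕ) → ∃ λ ω → 𝔼 n f ≤ Q ^ n * f ω
  ∃≥𝔼 zero f = [] , ≤-reflexive (sym (+-identityʳ (f [])))
  ∃≥𝔼 (suc n) f with ∃≥𝔼 n (f ∘ (true ∷_)) | ∃≥𝔼 n (f ∘ (false ∷_))
  ... | ω₁ , 𝔼₁≤ | ω₀ , 𝔼₀≤ with ≤-total (f (true ∷ ω₁)) (f (false ∷ ω₀))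
  ... | inj₁ f₁≤f₀ = false ∷ ω₀ , weighted-≤ (Q ^ n) (≤-trans 𝔼₁≤ (*-monoʳ-≤ (Q ^ n) f₁≤f₀)) 𝔼₀≤
  ... | inj₂ f₀≤f₁ = true ∷ ω₁ , weighted-≤ (Q ^ n) 𝔼₁≤ (≤-trans 𝔼₀≤ (*-monoʳ-≤ (Q ^ n) f₀≤f₁))

  𝔼-atLeast : ∀ n (A : Subset n) s →
    𝔼 n (λ ω → 𝟙 (s ≤ᵇ ∣ A ∩ ω ∣)) * Q ^ s ≤ (∣ A ∣ C s) * j ^ s * Q ^ n
  𝔼-atLeast n A zero = begin
    𝔼 n (λ _ → 1) * 1    ≡⟨ *-identityʳ _ ⟩
    𝔼 n (λ _ → 1)        ≡⟨ 𝔼-const n 1 ⟩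
    1 * Q ^ n            ∎
    where open ≤-Reasoning
  𝔼-atLeast zero [] (suc s) = z≤n
  𝔼-atLeast (suc n) (false ∷ A) (suc s) = begin
    (j * E + k * E) * Q ^ suc s              ≡⟨ lemma j k E (Q ^ suc s) ⟩
    Q * (E * Q ^ suc s)                      ≤⟨ *-monoʳ-≤ Q (𝔼-atLeast n A (suc s)) ⟩
    Q * ((∣ A ∣ C suc s) * j ^ suc s * Q ^ n)  ≡⟨ lemma′ Q ((∣ A ∣ C suc s) * j ^ suc s) (Q ^ n) ⟩
    (∣ A ∣ C suc s) * j ^ suc s * Q ^ suc n  ∎
    where
    open ≤-Reasoning
    E = 𝔼 n (λ ω → 𝟙 (suc s ≤ᵇ ∣ A ∩ ω ∣))
    lemma : ∀ j k e q → (j * e + k * e) * q ≡ (j + k) * (e * q)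
    lemma = solve-∀
    lemma′ : ∀ Q a b → Q * (a * b) ≡ a * (Q * b)
    lemma′ = solve-∀
  𝔼-atLeast (suc n) (true ∷ A) (suc s) = begin
    (j * E₁′ + k * E₂) * Q ^ suc s           ≡⟨ cong (λ x → (j * x + k * E₂) * Q ^ suc s) E₁′≡E₁ ⟩
    (j * E₁ + k * E₂) * Q ^ suc s            ≡⟨ lemma j k Q E₁ E₂ (Q ^ s) ⟩
    j * Q * (E₁ * Q ^ s) + k * (E₂ * Q ^ suc s)
                   ≤⟨ +-mono-≤ (*-monoʳ-≤ (j * Q) (𝔼-atLeast n A s)) (*-mono-≤ (m≤n+m k j) (𝔼-atLeast n A (suc s))) ⟩
    j * Q * ((m C s) * j ^ s * Q ^ n) + Q * ((m C suc s) * j ^ suc s * Q ^ n)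
                                             ≡⟨ lemma′ j Q (m C s) (m C suc s) (j ^ s) (Q ^ n) ⟩
    (m C s + m C suc s) * j ^ suc s * Q ^ suc n
                                             ≡⟨ cong (λ x → x * j ^ suc s * Q ^ suc n) (nCk+nC[k+1]≡[n+1]C[k+1] m s) ⟩
    (suc m C suc s) * j ^ suc s * Q ^ suc n  ∎
    where
    open ≤-Reasoning
    m = ∣ A ∣
    E₁′ = 𝔼 n (λ ω → 𝟙 (suc s ≤ᵇ suc ∣ A ∩ ω ∣))
    E₁ = 𝔼 n (λ ω → 𝟙 (s ≤ᵇ ∣ A ∩ ω ∣))
    E₂ = 𝔼 n (λ ω → 𝟙 (suc s ≤ᵇ ∣ A ∩ ω ∣))
    E₁′≡E₁ : E₁′ ≡ E₁
    E₁′≡E₁ = 𝔼-cong n (λ ω → cong 𝟙 (≤ᵇ-suc s ∣ A ∩ ω ∣))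
    lemma : ∀ j k Q a b q → (j * a + k * b) * (Q * q) ≡ j * Q * (a * q) + k * (b * (Q * q))
    lemma = solve-∀
    lemma′ : ∀ j Q c c′ x q → j * Q * (c * x * q) + Q * (c′ * (j * x) * q) ≡ (c + c′) * (j * x) * (Q * q)
    lemma′ = solve-∀

  𝔼-fewOutside : 1 ≤ j → ∀ n (A : Subset n) t e {D} → e + t ≤ ∣ A ∣ → ∣ A ∣ ≤ D →
    𝔼 n (λ ω → 𝟙 (∣ A ─ ω ∣ ≤ᵇ t)) * Q ^ e ≤ D ^ t * j ^ e * Q ^ n
  𝔼-fewOutside j≥1 n A t e {D} e+t≤m m≤D = *-cancelʳ-≤ _ _ (Q ^ f) {{m^n≢0 Q f}} (begin
    𝔼 n (λ ω → 𝟙 (∣ A ─ ω ∣ ≤ᵇ t)) * Q ^ e * Q ^ f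
                                    ≤⟨ *-monoˡ-≤ (Q ^ f) (*-monoˡ-≤ (Q ^ e) (𝔼-mono n few⇒many)) ⟩
    E * Q ^ e * Q ^ f               ≡⟨ *-assoc E (Q ^ e) (Q ^ f) ⟩
    E * (Q ^ e * Q ^ f)             ≡⟨ cong (E *_) (trans (sym (^-distribˡ-+-* Q e f)) (cong (Q ^_) e+f≡s)) ⟩
    E * Q ^ s                       ≤⟨ 𝔼-atLeast n A s ⟩
    (m C s) * j ^ s * Q ^ n         ≡⟨ cong (λ c → c * j ^ s * Q ^ n) (nCk≡nC[n∸k] t≤m) ⟨
    (m C t) * j ^ s * Q ^ n         ≤⟨ *-monoˡ-≤ (Q ^ n) (*-monoˡ-≤ (j ^ s) (≤-trans (nCk≤n^k m t) (^-monoˡ-≤ t m≤D))) ⟩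
    D ^ t * j ^ s * Q ^ n           ≡⟨ cong (λ x → D ^ t * x * Q ^ n) (trans (cong (j ^_) (sym e+f≡s)) (^-distribˡ-+-* j e f)) ⟩
    D ^ t * (j ^ e * j ^ f) * Q ^ n ≤⟨ *-monoˡ-≤ (Q ^ n) (*-monoʳ-≤ (D ^ t) (*-monoʳ-≤ (j ^ e) (^-monoˡ-≤ f (m≤m+n j k)))) ⟩
    D ^ t * (j ^ e * Q ^ f) * Q ^ n ≡⟨ lemma (D ^ t) (j ^ e) (Q ^ f) (Q ^ n) ⟩
    D ^ t * j ^ e * Q ^ n * Q ^ f   ∎)
    where
    open ≤-Reasoning
    instance
      Q≢0 : NonZero Q
      Q≢0 = >-nonZero (≤-trans j≥1 (m≤m+n j k))
    m = ∣ A ∣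
    s = m ∸ t
    f = s ∸ e
    E = 𝔼 n (λ ω → 𝟙 (s ≤ᵇ ∣ A ∩ ω ∣))
    few⇒many : ∀ ω → 𝟙 (∣ A ─ ω ∣ ≤ᵇ t) ≤ 𝟙 (s ≤ᵇ ∣ A ∩ ω ∣)
    few⇒many ω = 𝟙-≤ᵇ-mono λ few → m≤n+o⇒m∸n≤o m t (begin
      m                         ≡⟨ ∣p─q∣+∣p∩q∣≡∣p∣ A ω ⟨
      ∣ A ─ ω ∣ + ∣ A ∩ ω ∣     ≤⟨ +-monoˡ-≤ ∣ A ∩ ω ∣ few ⟩
      t + ∣ A ∩ ω ∣             ∎)
    t≤m : t ≤ m
    t≤m = ≤-trans (m≤n+m t e) e+t≤m
    e+f≡s : e + f ≡ s
    e+f≡s = m+[n∸m]≡n (m+n≤o⇒m≤o∸n e e+t≤m)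
    lemma : ∀ a b c d → a * (b * c) * d ≡ a * b * d * c
    lemma = solve-∀

*-^-distrib : ∀ a b d → (a * b) ^ d ≡ a ^ d * b ^ d
*-^-distrib a b zero = refl
*-^-distrib a b (suc d) rewrite *-^-distrib a b d = lemma a b (a ^ d) (b ^ d)
  where
  lemma : ∀ a b x y → a * b * (x * y) ≡ a * x * (b * y)
  lemma = solve-∀

first-crossing : ∀ {P : ℕ → Set} → Decidable P → ¬ P 0 → ∀ N → P N → ∃ λ x → ¬ P x × P (suc x)
first-crossing P? ¬P0 zero P0 = ⊥-elim (¬P0 P0)
first-crossing P? ¬P0 (suc N) PsN with P? N
... | yes PN = first-crossing P? ¬P0 N PN
... | no ¬PN = N , ¬PN , PsN

bernoulli : ∀ d x → suc x ^ d * suc x ≤ x ^ d * suc x + d * suc x ^ d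
bernoulli zero x = ≤-reflexive (sym (+-identityʳ _))
bernoulli (suc d) x = begin
  suc x ^ suc d * suc x
    ≡⟨ lemma₁ (suc x) (suc x ^ d) ⟩
  suc x * (suc x ^ d * suc x)
    ≤⟨ *-monoʳ-≤ (suc x) (bernoulli d x) ⟩
  suc x * (x ^ d * suc x + d * suc x ^ d)
    ≡⟨ lemma₂ x (x ^ d) (suc x ^ d) d ⟩
  x ^ d * x * suc x + x ^ d * suc x + d * (suc x * suc x ^ d)
    ≤⟨ +-monoˡ-≤ _ (+-monoʳ-≤ (x ^ d * x * suc x) (*-monoˡ-≤ (suc x) (^-monoˡ-≤ d (n≤1+n x)))) ⟩
  x ^ d * x * suc x + suc x ^ d * suc x + d * (suc x * suc x ^ d)
    ≡⟨ lemma₃ x (x ^ d) (suc x ^ d) d ⟩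
  x * x ^ d * suc x + suc d * (suc x * suc x ^ d) ∎
  where
  open ≤-Reasoning
  lemma₁ : ∀ y z → y * z * y ≡ y * (z * y)
  lemma₁ = solve-∀
  lemma₂ : ∀ x a b d → (1 + x) * (a * (1 + x) + d * b) ≡ a * x * (1 + x) + a * (1 + x) + d * ((1 + x) * b)
  lemma₂ = solve-∀
  lemma₃ : ∀ x a b d → a * x * (1 + x) + b * (1 + x) + d * ((1 + x) * b) ≡ x * a * (1 + x) + (1 + d) * ((1 + x) * b)
  lemma₃ = solve-∀

-- By Bernoulli, ((x + 1)/x)^d ≤ (x + 1)/(x + 1 − d), which is at most 3/2 once x + 1 ≥ 3d.
2[1+x]^d≤3x^d : ∀ d x → 3 * d ≤ suc x → 2 * suc x ^ d ≤ 3 * x ^ d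
2[1+x]^d≤3x^d d x 3d≤j = *-cancelʳ-≤ _ _ j (+-cancelʳ-≤ (j ^ d * j) _ _ (begin
  2 * j ^ d * j + j ^ d * j          ≡⟨ lemma₁ (j ^ d) j ⟩
  3 * (j ^ d * j)                    ≤⟨ *-monoʳ-≤ 3 (bernoulli d x) ⟩
  3 * (x ^ d * j + d * j ^ d)        ≡⟨ lemma₂ (x ^ d) (j ^ d) j d ⟩
  3 * x ^ d * j + 3 * d * j ^ d      ≤⟨ +-monoʳ-≤ (3 * x ^ d * j) (≤-trans (*-monoˡ-≤ (j ^ d) 3d≤j) (≤-reflexive (*-comm j (j ^ d)))) ⟩
  3 * x ^ d * j + j ^ d * j          ∎))
  where
  open ≤-Reasoning
  j = suc x
  lemma₁ : ∀ a j → 2 * a * j + a * j ≡ 3 * (a * j)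
  lemma₁ = solve-∀
  lemma₂ : ∀ b a j d → 3 * (b * j + d * a) ≡ 3 * b * j + 3 * d * a
  lemma₂ = solve-∀

∃-dth-root-approx : ∀ T d → 1 ≤ T → 1 ≤ d →
  ∃₂ λ j k → 1 ≤ j × (j + k) ^ d ≤ T * j ^ d × 2 * (T * j ^ d) ≤ 3 * (j + k) ^ d
∃-dth-root-approx T d@(suc d′) T≥1 d≥1 = approx (first-crossing (λ x → Q ^ d ≤? T * x ^ d) ¬P0 Q (m≤n*m (Q ^ d) T))
  where
  open ≤-Reasoning
  Q = T * (3 * d)
  instance
    T≢0 : NonZero T
    T≢0 = >-nonZero T≥1
    Q≢0 : NonZero Q
    Q≢0 = m*n≢0 T (3 * d)
  ¬P0 : ¬ (Q ^ d ≤ T * 0 ^ d)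
  ¬P0 Q^d≤0 = <⇒≱ (m^n>0 Q d) (≤-trans Q^d≤0 (≤-reflexive (*-zeroʳ T)))
  T*[3d]^d≤Q^d : T * (3 * d) ^ d ≤ Q ^ d
  T*[3d]^d≤Q^d = begin
    T * (3 * d) ^ d          ≡⟨ cong (_* (3 * d) ^ d) (*-identityʳ T) ⟨
    T ^ 1 * (3 * d) ^ d      ≤⟨ *-monoˡ-≤ ((3 * d) ^ d) (^-monoʳ-≤ T d≥1) ⟩
    T ^ d * (3 * d) ^ d      ≡⟨ *-^-distrib T (3 * d) d ⟨
    Q ^ d                    ∎
  approx : (∃ λ x → ¬ (Q ^ d ≤ T * x ^ d) × Q ^ d ≤ T * suc x ^ d) →
    ∃₂ λ j k → 1 ≤ j × (j + k) ^ d ≤ T * j ^ d × 2 * (T * j ^ d) ≤ 3 * (j + k) ^ d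
  approx (x , Q^d≰T*x^d , Q^d≤T*j^d) =
    j , Q ∸ j , s≤s z≤n , subst (λ q → q ^ d ≤ T * j ^ d × 2 * (T * j ^ d) ≤ 3 * q ^ d) (sym j+[Q∸j]≡Q) (Q^d≤T*j^d , 2T*j^d≤3Q^d)
    where
    j = suc x
    j+[Q∸j]≡Q : j + (Q ∸ j) ≡ Q
    j+[Q∸j]≡Q = m+[n∸m]≡n (≮⇒≥ λ Q<j → Q^d≰T*x^d (≤-trans (m≤n*m (Q ^ d) T) (*-monoʳ-≤ T (^-monoˡ-≤ d (≤-pred Q<j)))))
    3d≤j : 3 * d ≤ j
    3d≤j = ≮⇒≥ λ j<3d → <⇒≱ (*-monoʳ-< T (^-monoˡ-< d j<3d)) (≤-trans T*[3d]^d≤Q^d Q^d≤T*j^d)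
    2T*j^d≤3Q^d : 2 * (T * j ^ d) ≤ 3 * Q ^ d
    2T*j^d≤3Q^d = begin
      2 * (T * j ^ d)     ≡⟨ lemma T (j ^ d) ⟩
      T * (2 * j ^ d)     ≤⟨ *-monoʳ-≤ T (2[1+x]^d≤3x^d d x 3d≤j) ⟩
      T * (3 * x ^ d)     ≡⟨ lemma′ T (x ^ d) ⟩
      3 * (T * x ^ d)     ≤⟨ *-monoʳ-≤ 3 (<⇒≤ (≰⇒> Q^d≰T*x^d)) ⟩
      3 * Q ^ d           ∎
      where
      lemma : ∀ T a → 2 * (T * a) ≡ T * (2 * a)
      lemma = solve-∀
      lemma′ : ∀ T a → T * (3 * a) ≡ 3 * (T * a)
      lemma′ = solve-∀

survivors-≥ : ∀ n s j Q d L → 1 ≤ j → j ≤ Q → suc d * L * j ^ d ≤ Q ^ d →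
  n * j * Q ^ suc d ≤ Q ^ (2 + d) * s + n * L * j ^ (2 + d) →
  d * n * j ≤ suc d * Q * s
survivors-≥ n s j Q d L j≥1 j≤Q dLj^d≤Q^d mean≤ =
  *-cancelʳ-≤ _ _ (Q ^ suc d) {{m^n≢0 Q (suc d) {{>-nonZero (≤-trans j≥1 j≤Q)}}}} (begin
    d * n * j * Q ^ suc d        ≡⟨ lemma d n j (Q ^ suc d) ⟩
    d * X                        ≤⟨ +-cancelʳ-≤ X _ _ (begin
      d * X + X                    ≡⟨ +-comm (d * X) X ⟩
      suc d * X                    ≤⟨ *-monoʳ-≤ (suc d) mean≤ ⟩
      suc d * (B + loss)           ≡⟨ *-distribˡ-+ (suc d) B loss ⟩
      suc d * B + suc d * loss     ≤⟨ +-monoʳ-≤ (suc d * B) loss≤ ⟩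
      suc d * B + X                ∎) ⟩
    suc d * B                    ≡⟨ lemma′ (suc d) Q (Q ^ suc d) s ⟩
    suc d * Q * s * Q ^ suc d    ∎)
  where
  open ≤-Reasoning
  X = n * j * Q ^ suc d
  B = Q ^ (2 + d) * s
  loss = n * L * j ^ (2 + d)
  loss≤ : suc d * loss ≤ X
  loss≤ = begin
    suc d * (n * L * (j * (j * j ^ d)))  ≡⟨ lemma″ (suc d) n L j (j ^ d) ⟩
    n * j * j * (suc d * L * j ^ d)      ≤⟨ *-monoʳ-≤ (n * j * j) dLj^d≤Q^d ⟩
    n * j * j * Q ^ d                    ≤⟨ *-monoˡ-≤ (Q ^ d) (*-monoʳ-≤ (n * j) j≤Q) ⟩
    n * j * Q * Q ^ d                    ≡⟨ *-assoc (n * j) Q (Q ^ d) ⟩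
    X                                    ∎
    where
    lemma″ : ∀ a n L j b → a * (n * L * (j * (j * b))) ≡ n * j * j * (a * L * b)
    lemma″ = solve-∀
  lemma : ∀ d n j q → d * n * j * q ≡ d * (n * j * q)
  lemma = solve-∀
  lemma′ : ∀ a Q b s → a * (Q * b * s) ≡ a * Q * s * b
  lemma′ = solve-∀

dth-power-bound : ∀ n s j Q d T → 1 ≤ j → Q ^ d ≤ T * j ^ d → d * n * j ≤ suc d * Q * s →
  d ^ d * n ^ d ≤ s ^ d * suc d ^ d * T
dth-power-bound n s j Q d T j≥1 Q^d≤T*j^d dnj≤ =
  *-cancelʳ-≤ _ _ (j ^ d) {{m^n≢0 j d {{>-nonZero j≥1}}}} (begin
    d ^ d * n ^ d * j ^ d           ≡⟨ trans (*-^-distrib (d * n) j d) (cong (_* j ^ d) (*-^-distrib d n d)) ⟨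
    (d * n * j) ^ d                 ≤⟨ ^-monoˡ-≤ d dnj≤ ⟩
    (suc d * Q * s) ^ d             ≡⟨ trans (*-^-distrib (suc d * Q) s d) (cong (_* s ^ d) (*-^-distrib (suc d) Q d)) ⟩
    suc d ^ d * Q ^ d * s ^ d       ≤⟨ *-monoˡ-≤ (s ^ d) (*-monoʳ-≤ (suc d ^ d) Q^d≤T*j^d) ⟩
    suc d ^ d * (T * j ^ d) * s ^ d ≡⟨ lemma (suc d ^ d) T (j ^ d) (s ^ d) ⟩
    s ^ d * suc d ^ d * T * j ^ d   ∎)
  where
  open ≤-Reasoning
  lemma : ∀ a T b c → a * (T * b) * c ≡ c * a * T * b
  lemma = solve-∀

3[1+D²]D^r≤4rD^[r+2] : ∀ D t → 3 ≤ D → 3 * (D ^ suc t * (1 + D * D)) ≤ 2 * (D ^ (suc t + 2) * (2 * suc t))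
3[1+D²]D^r≤4rD^[r+2] D t D≥3 = begin
  3 * (D ^ suc t * (1 + D * D))            ≡⟨ lemma₁ (D ^ suc t) D ⟩
  D ^ suc t * (3 + 3 * (D * D))            ≤⟨ *-monoʳ-≤ (D ^ suc t) (+-monoˡ-≤ (3 * (D * D)) (≤-trans D≥3 (m≤m*n D D))) ⟩
  D ^ suc t * (D * D + 3 * (D * D))        ≡⟨ lemma₂ (D ^ suc t) (D * D) ⟩
  D ^ suc t * (D * D) * 4                  ≤⟨ *-monoʳ-≤ (D ^ suc t * (D * D)) (*-monoʳ-≤ 4 (s≤s (z≤n {t}))) ⟩
  D ^ suc t * (D * D) * (4 * suc t)        ≡⟨ lemma₃ (D ^ suc t) D (suc t) ⟩
  2 * (D ^ suc t * (D * (D * 1)) * (2 * suc t)) ≡⟨ cong (λ x → 2 * (x * (2 * suc t))) (^-distribˡ-+-* D (suc t) 2) ⟨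
  2 * (D ^ (suc t + 2) * (2 * suc t))      ∎
  where
  open ≤-Reasoning
  instance
    D≢0 : NonZero D
    D≢0 = >-nonZero (≤-trans (s≤s z≤n) D≥3)
  lemma₁ : ∀ a D → 3 * (a * (1 + D * D)) ≡ a * (3 + 3 * (D * D))
  lemma₁ = solve-∀
  lemma₂ : ∀ a x → a * (x + 3 * x) ≡ a * x * 4
  lemma₂ = solve-∀
  lemma₃ : ∀ a D r → a * (D * D) * (4 * r) ≡ 2 * (a * (D * (D * 1)) * (2 * r))
  lemma₃ = solve-∀

≢-witness : ∀ {n} → 2 ≤ n → (v : Fin n) → ∃ λ u → u ≢ v
≢-witness (s≤s (s≤s _)) zero = suc zero , λ ()
≢-witness (s≤s (s≤s _)) (suc v) = zero , λ ()

≤-max-tabulate : ∀ {n} (f : Fin n → ℕ) i → f i ≤ foldr′ _⊔_ 0 (tabulate f)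
≤-max-tabulate f zero = m≤m⊔n (f zero) _
≤-max-tabulate f (suc i) = ≤-trans (≤-max-tabulate (f ∘ suc) i) (m≤n⊔m (f zero) _)

max-tabulate-≤ : ∀ {n m} (f : Fin n → ℕ) → (∀ i → f i ≤ m) → foldr′ _⊔_ 0 (tabulate f) ≤ m
max-tabulate-≤ {zero} f f≤m = z≤n
max-tabulate-≤ {suc n} f f≤m = ⊔-lub (f≤m zero) (max-tabulate-≤ (f ∘ suc) (f≤m ∘ suc))

module Neighbourhoods {n : ℕ} (G : Graph n) where

  Δ : ℕ
  Δ = maxDegree G

  N⟦_⟧ : Fin n → Subset n
  N⟦ v ⟧ = N[_] G v

  ∈ᵇN⟦⟧ : ∀ x v → x ∈ᵇ N⟦ v ⟧ ≡ (⌊ x ≟ v ⌋ ∨ adj G v x)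
  ∈ᵇN⟦⟧ x v = lookup∘tabulate _ x

  ∈ᵇN : ∀ x v → x ∈ᵇ N G v ≡ adj G v x
  ∈ᵇN x v = lookup∘tabulate _ x

  N⟦⟧-sym : ∀ x v → x ∈ᵇ N⟦ v ⟧ ≡ v ∈ᵇ N⟦ x ⟧
  N⟦⟧-sym x v rewrite ∈ᵇN⟦⟧ x v | ∈ᵇN⟦⟧ v x | adj-sym G v x with x ≟ v | v ≟ x
  ... | yes _ | yes _ = refl
  ... | no _ | no _ = refl
  ... | yes x≡v | no v≢x = ⊥-elim (v≢x (sym x≡v))
  ... | no x≢v | yes v≡x = ⊥-elim (x≢v (sym v≡x))

  degree<n : ∀ v → degree G v < n
  degree<n v = subst (degree G v <_) (∣⊤∣≡n n) (p⊂q⇒∣p∣<∣q∣ (⊆⊤ , v , ∈⊤ , v∉N[v]))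
    where
    v∉N[v] : v ∉ N G v
    v∉N[v] v∈N[v] = false≢true (trans (sym (adj-irrefl G v)) (trans (sym (∈ᵇN v v)) ([]=⇒lookup v∈N[v])))
      where
      false≢true : false ≢ true
      false≢true ()

  2≤Δ⇒2≤n : 2 ≤ Δ → 2 ≤ n
  2≤Δ⇒2≤n 2≤Δ = ≤-trans 2≤Δ (≤-trans (max-tabulate-≤ (degree G) (suc[m]≤n⇒m≤pred[n] ∘ degree<n)) pred[n]≤n)

  ∣N⟦⟧∣≤Δ+1 : ∀ v → ∣ N⟦ v ⟧ ∣ ≤ Δ + 1
  ∣N⟦⟧∣≤Δ+1 v = begin
    ∣ N⟦ v ⟧ ∣                        ≤⟨ ∣p∣≤∣p─q∣+∣q∣ N⟦ v ⟧ (N G v) ⟩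
    ∣ N⟦ v ⟧ ─ N G v ∣ + ∣ N G v ∣    ≤⟨ +-mono-≤ (∣∣-mono (N⟦ v ⟧ ─ N G v) ⁅ v ⁆ only-v) (≤-max-tabulate (degree G) v) ⟩
    ∣ ⁅ v ⁆ ∣ + Δ                     ≡⟨ cong (_+ Δ) (∣⁅x⁆∣≡1 v) ⟩
    1 + Δ                             ≡⟨ +-comm 1 Δ ⟩
    Δ + 1                             ∎
    where
    open ≤-Reasoning
    only-v : ∀ x → x ∈ᵇ (N⟦ v ⟧ ─ N G v) ≡ true → x ∈ᵇ ⁅ v ⁆ ≡ true
    only-v x x∈ rewrite ∈ᵇ-─ N⟦ v ⟧ (N G v) x | ∈ᵇN⟦⟧ x v | ∈ᵇN x v with x ≟ v | adj G v x
    only-v x x∈ | yes refl | _ = []=⇒lookup (x∈⁅x⁆ x)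
    only-v x () | no _ | true
    only-v x () | no _ | false

  incidence≤ : ∀ (S : Fin n → Bool) →
    ∑[ x < n ] ∑[ v < n ] 𝟙 (S v ∧ x ∈ᵇ N⟦ v ⟧) ≤ (Δ + 1) * ∑[ v < n ] 𝟙 (S v)
  incidence≤ S = begin
    ∑[ x < n ] ∑[ v < n ] 𝟙 (S v ∧ x ∈ᵇ N⟦ v ⟧)    ≡⟨ ∑-comm (λ x v → 𝟙 (S v ∧ x ∈ᵇ N⟦ v ⟧)) ⟩
    ∑[ v < n ] ∑[ x < n ] 𝟙 (S v ∧ x ∈ᵇ N⟦ v ⟧)    ≡⟨ sum-cong-≗ (λ v → ∑-𝟙∧ (S v) N⟦ v ⟧) ⟩
    ∑[ v < n ] (𝟙 (S v) * ∣ N⟦ v ⟧ ∣)              ≤⟨ ∑-mono-≤ (λ v → *-monoʳ-≤ (𝟙 (S v)) (∣N⟦⟧∣≤Δ+1 v)) ⟩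
    ∑[ v < n ] (𝟙 (S v) * (Δ + 1))                 ≡⟨ sum-cong-≗ (λ v → *-comm (𝟙 (S v)) (Δ + 1)) ⟩
    ∑[ v < n ] ((Δ + 1) * 𝟙 (S v))                 ≡⟨ *-distribˡ-sum (Δ + 1) (𝟙 ∘ S) ⟨
    (Δ + 1) * ∑[ v < n ] 𝟙 (S v)                   ∎
    where open ≤-Reasoning

  n≤[Δ+1]∣𝒞∣ : 2 ≤ n → ∀ {r} 𝒞 → 1 ≤ r → IsIdCode G r 𝒞 → n ≤ (Δ + 1) * ∣ 𝒞 ∣
  n≤[Δ+1]∣𝒞∣ 2≤n 𝒞 r≥1 isCode = begin
    n                                              ≡⟨ *-identityʳ n ⟨
    n * 1                                          ≡⟨ ∑-const n 1 ⟨
    ∑[ v < n ] 1                                   ≤⟨ ∑-mono-≤ dominated ⟩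
    ∑[ v < n ] ∣ N⟦ v ⟧ ∩ 𝒞 ∣                      ≡⟨ sum-cong-≗ (λ v → trans (∣p∣≡∑𝟙 (N⟦ v ⟧ ∩ 𝒞)) (sum-cong-≗ (swap v))) ⟩
    ∑[ v < n ] ∑[ x < n ] 𝟙 (x ∈ᵇ 𝒞 ∧ v ∈ᵇ N⟦ x ⟧) ≤⟨ incidence≤ (_∈ᵇ 𝒞) ⟩
    (Δ + 1) * ∑[ x < n ] 𝟙 (x ∈ᵇ 𝒞)                ≡⟨ cong ((Δ + 1) *_) (∣p∣≡∑𝟙 𝒞) ⟨
    (Δ + 1) * ∣ 𝒞 ∣                                ∎
    where
    open ≤-Reasoning
    swap : ∀ v x → 𝟙 (x ∈ᵇ (N⟦ v ⟧ ∩ 𝒞)) ≡ 𝟙 (x ∈ᵇ 𝒞 ∧ v ∈ᵇ N⟦ x ⟧)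
    swap v x = cong 𝟙 (trans (∈ᵇ-∩ N⟦ v ⟧ 𝒞 x)
      (trans (∧-comm (x ∈ᵇ N⟦ v ⟧) (x ∈ᵇ 𝒞)) (cong (x ∈ᵇ 𝒞 ∧_) (N⟦⟧-sym x v))))
    dominated : ∀ v → 1 ≤ ∣ N⟦ v ⟧ ∩ 𝒞 ∣
    dominated v with ≢-witness 2≤n v
    ... | u , u≢v = ≤-trans r≥1 (≤-trans (isCode u v u≢v) (∣∣-mono ((N⟦ v ⟧ ─ N⟦ u ⟧) ∩ 𝒞) (N⟦ v ⟧ ∩ 𝒞) sep∩𝒞⊆))
      where
      sep∩𝒞⊆ : ∀ x → x ∈ᵇ ((N⟦ v ⟧ ─ N⟦ u ⟧) ∩ 𝒞) ≡ true → x ∈ᵇ (N⟦ v ⟧ ∩ 𝒞) ≡ true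
      sep∩𝒞⊆ x rewrite ∈ᵇ-∩ (N⟦ v ⟧ ─ N⟦ u ⟧) 𝒞 x | ∈ᵇ-─ N⟦ v ⟧ N⟦ u ⟧ x | ∈ᵇ-∩ N⟦ v ⟧ 𝒞 x
        with x ∈ᵇ N⟦ v ⟧ | x ∈ᵇ N⟦ u ⟧
      ... | true | false = λ x∈𝒞 → x∈𝒞
      ... | true | true = λ ()
      ... | false | _ = λ ()

module RandomCode {n : ℕ} (G : Graph n) (t d : ℕ) (strong : StrongNbhd G (suc t + d + 1)) where

  open Neighbourhoods G

  sep : Fin n → Fin n → Subset n
  sep u v = N⟦ v ⟧ ─ N⟦ u ⟧

  fewOutside : Subset n → Subset n → Bool
  fewOutside A ω = ∣ A ─ ω ∣ ≤ᵇ t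

  bad : Subset n → Fin n → Bool
  bad ω v = any λ u → not ⌊ u ≟ v ⌋ ∧ fewOutside (sep u v) ω

  covered : Subset n → Subset n
  covered ω = tabulate λ x → any λ v → bad ω v ∧ x ∈ᵇ N⟦ v ⟧

  removed : Subset n → Subset n
  removed ω = ω ─ covered ω

  code : Subset n → Subset n
  code ω = ∁ (removed ω)

  2+d+t≤∣sep∣ : ∀ {u v} → u ≢ v → 2 + d + t ≤ ∣ sep u v ∣
  2+d+t≤∣sep∣ {u} {v} u≢v = subst (_≤ ∣ sep u v ∣) (lemma t d) (strong u v u≢v)
    where
    lemma : ∀ t d → suc t + d + 1 ≡ 2 + d + t
    lemma = solve-∀

  ∣sep∣≤Δ+1 : ∀ u v → ∣ sep u v ∣ ≤ Δ + 1
  ∣sep∣≤Δ+1 u v = ≤-trans (∣p─q∣≤∣p∣ N⟦ v ⟧ N⟦ u ⟧) (∣N⟦⟧∣≤Δ+1 v)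

  code-isIdCode : ∀ ω → IsIdCode G (suc t) (code ω)
  code-isIdCode ω u v u≢v with bad ω v in bad-v
  ... | true = ≤-trans r≤∣sep∣ (∣∣-mono (sep u v) (sep u v ∩ code ω) sep⊆code)
    where
    r≤∣sep∣ : suc t ≤ ∣ sep u v ∣
    r≤∣sep∣ = ≤-trans (m≤n+m (suc t) (1 + d)) (≤-trans (≤-reflexive (+-suc (1 + d) t)) (2+d+t≤∣sep∣ u≢v))
    sep⊆code : ∀ x → x ∈ᵇ sep u v ≡ true → x ∈ᵇ (sep u v ∩ code ω) ≡ true
    sep⊆code x x∈sep = ∈ᵇ-∩⁺ (sep u v) (code ω) x x∈sep (∈ᵇ-∁-─ ω (covered ω) x (inj₂ x∈covered))
      where
      x∈covered : x ∈ᵇ covered ω ≡ true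
      x∈covered = trans (lookup∘tabulate _ x)
        (any-intro _ v (cong₂ _∧_ bad-v (proj₁ (∈ᵇ-─⁻ N⟦ v ⟧ N⟦ u ⟧ x x∈sep))))
  ... | false = ≤-trans (≤ᵇ≡false⇒> few≡false) (∣∣-mono (sep u v ─ ω) (sep u v ∩ code ω) outside⊆code)
    where
    few≡false : fewOutside (sep u v) ω ≡ false
    few≡false = trans (cong (λ b → not b ∧ fewOutside (sep u v) ω) (sym (⌊≟⌋-≢ u≢v))) (any-false _ bad-v u)
    outside⊆code : ∀ x → x ∈ᵇ (sep u v ─ ω) ≡ true → x ∈ᵇ (sep u v ∩ code ω) ≡ true
    outside⊆code x x∈ =
      ∈ᵇ-∩⁺ (sep u v) (code ω) x (proj₁ x∈sep×x∉ω) (∈ᵇ-∁-─ ω (covered ω) x (inj₁ (proj₂ x∈sep×x∉ω)))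
      where
      x∈sep×x∉ω = ∈ᵇ-─⁻ (sep u v) ω x x∈

  ∣ω∣≤∣removed∣+[Δ+1]#bad : ∀ ω → ∣ ω ∣ ≤ ∣ removed ω ∣ + (Δ + 1) * ∑[ v < n ] 𝟙 (bad ω v)
  ∣ω∣≤∣removed∣+[Δ+1]#bad ω = ≤-trans (∣p∣≤∣p─q∣+∣q∣ ω (covered ω)) (+-monoʳ-≤ ∣ removed ω ∣ (begin
    ∣ covered ω ∣                                    ≡⟨ ∣p∣≡∑𝟙 (covered ω) ⟩
    ∑[ x < n ] 𝟙 (x ∈ᵇ covered ω)                    ≡⟨ sum-cong-≗ (λ x → cong 𝟙 (lookup∘tabulate (any ∘ covers) x)) ⟩
    ∑[ x < n ] 𝟙 (any (covers x))                    ≤⟨ ∑-mono-≤ (λ x → 𝟙-any≤∑ (covers x)) ⟩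
    ∑[ x < n ] ∑[ v < n ] 𝟙 (bad ω v ∧ x ∈ᵇ N⟦ v ⟧)  ≤⟨ incidence≤ (bad ω) ⟩
    (Δ + 1) * ∑[ v < n ] 𝟙 (bad ω v)                 ∎))
    where
    open ≤-Reasoning
    covers : Fin n → Fin n → Bool
    covers x v = bad ω v ∧ x ∈ᵇ N⟦ v ⟧

  near : Fin n → Fin n → Bool
  near v u = not ⌊ u ≟ v ⌋ ∧ (1 ≤ᵇ ∣ N⟦ v ⟧ ∩ N⟦ u ⟧ ∣)

  near⇒≢ : ∀ {v u} → near v u ≡ true → u ≢ v
  near⇒≢ {v} near-vu refl = contradiction (trans (sym (cong not (⌊≟⌋-refl v))) (proj₁ (∧≡true⁻ near-vu))) λ ()

  ∑near≤[Δ+1]² : ∀ v → ∑[ u < n ] 𝟙 (near v u) ≤ (Δ + 1) * (Δ + 1)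
  ∑near≤[Δ+1]² v = begin
    ∑[ u < n ] 𝟙 (near v u)                              ≤⟨ ∑-mono-≤ (λ u → ≤-trans (𝟙-∧≤ʳ _ _) (𝟙[1≤ᵇm]≤m ∣ N⟦ v ⟧ ∩ N⟦ u ⟧ ∣)) ⟩
    ∑[ u < n ] ∣ N⟦ v ⟧ ∩ N⟦ u ⟧ ∣                       ≡⟨ sum-cong-≗ (λ u → trans (∣p∣≡∑𝟙 (N⟦ v ⟧ ∩ N⟦ u ⟧)) (sum-cong-≗ (common u))) ⟩
    ∑[ u < n ] ∑[ w < n ] 𝟙 (w ∈ᵇ N⟦ v ⟧ ∧ u ∈ᵇ N⟦ w ⟧)  ≤⟨ incidence≤ (_∈ᵇ N⟦ v ⟧) ⟩
    (Δ + 1) * ∑[ w < n ] 𝟙 (w ∈ᵇ N⟦ v ⟧)                 ≡⟨ cong ((Δ + 1) *_) (∣p∣≡∑𝟙 N⟦ v ⟧) ⟨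
    (Δ + 1) * ∣ N⟦ v ⟧ ∣                                 ≤⟨ *-monoʳ-≤ (Δ + 1) (∣N⟦⟧∣≤Δ+1 v) ⟩
    (Δ + 1) * (Δ + 1)                                    ∎
    where
    open ≤-Reasoning
    common : ∀ u w → 𝟙 (w ∈ᵇ (N⟦ v ⟧ ∩ N⟦ u ⟧)) ≡ 𝟙 (w ∈ᵇ N⟦ v ⟧ ∧ u ∈ᵇ N⟦ w ⟧)
    common u w = cong 𝟙 (trans (∈ᵇ-∩ N⟦ v ⟧ N⟦ u ⟧ w) (cong (w ∈ᵇ N⟦ v ⟧ ∧_) (N⟦⟧-sym w u)))

  threats : Subset n → Fin n → ℕ
  threats ω v = 𝟙 (fewOutside N⟦ v ⟧ ω) + ∑[ u < n ] (𝟙 (near v u) * 𝟙 (fewOutside (sep u v) ω))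

  -- A u whose closed neighbourhood misses N[v] has sep u v = N[v], so its event is the first summand.
  bad≤threats : ∀ ω v → 𝟙 (bad ω v) ≤ threats ω v
  bad≤threats ω v with bad ω v in bad-v
  ... | false = z≤n
  ... | true with any-witness _ bad-v
  ... | u , u-threat with ∧≡true⁻ u-threat | near v u in near-vu
  ... | u≢v , few | true =
    ≤-trans (≤-reflexive (sym (cong₂ (λ a b → 𝟙 a * 𝟙 b) near-vu few)))
            (≤-trans (f≤∑f (λ u → 𝟙 (near v u) * 𝟙 (fewOutside (sep u v) ω)) u) (m≤n+m _ _))
  ... | u≢v , few | false = ≤-trans (≤-reflexive (cong 𝟙 (sym few-N⟦v⟧))) (m≤m+n _ _)
    where
    disjoint : ∣ N⟦ v ⟧ ∩ N⟦ u ⟧ ∣ ≡ 0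
    disjoint = n<1⇒n≡0 (≤ᵇ≡false⇒> (trans (cong (_∧ (1 ≤ᵇ ∣ N⟦ v ⟧ ∩ N⟦ u ⟧ ∣)) (sym u≢v)) near-vu))
    few-N⟦v⟧ : fewOutside N⟦ v ⟧ ω ≡ true
    few-N⟦v⟧ = trans (cong (λ A → fewOutside A ω) (sym (∣p∩q∣≡0⇒p─q≡p N⟦ v ⟧ N⟦ u ⟧ disjoint))) few

  L : ℕ
  L = (Δ + 1) ^ suc t * (1 + (Δ + 1) * (Δ + 1))

  module _ (j k : ℕ) (j≥1 : 1 ≤ j) (2≤n : 2 ≤ n) where
    open BernoulliSum j k

    -- Q ^ (n + 2 + d) times the probability bound (Δ + 1) ^ t · p ^ (2 + d) of each event fewOutside (sep u v).
    B : ℕ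
    B = (Δ + 1) ^ t * j ^ (2 + d) * Q ^ n

    𝔼-fewOutside≤B : ∀ A → 2 + d + t ≤ ∣ A ∣ → ∣ A ∣ ≤ Δ + 1 → 𝔼 n (𝟙 ∘ fewOutside A) * Q ^ (2 + d) ≤ B
    𝔼-fewOutside≤B A = 𝔼-fewOutside j≥1 n A t (2 + d)

    𝔼-threats≤ : ∀ v → 𝔼 n (λ ω → threats ω v) * Q ^ (2 + d) ≤ B * (1 + (Δ + 1) * (Δ + 1))
    𝔼-threats≤ v = begin
      𝔼 n (λ ω → threats ω v) * e          ≡⟨ cong (_* e) 𝔼-threats ⟩
      (E-N⟦v⟧ + ∑[ u < n ] (𝟙 (near v u) * E-sep u)) * e
                                           ≡⟨ trans (*-distribʳ-+ e E-N⟦v⟧ _)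
                                                (cong (E-N⟦v⟧ * e +_) (*-distribʳ-sum e (λ u → 𝟙 (near v u) * E-sep u))) ⟩
      E-N⟦v⟧ * e + ∑[ u < n ] (𝟙 (near v u) * E-sep u * e)
                                           ≤⟨ +-mono-≤ E-N⟦v⟧≤B (∑-mono-≤ near-term≤) ⟩
      B + ∑[ u < n ] (𝟙 (near v u) * B)    ≡⟨ cong (B +_) (*-distribʳ-sum B (𝟙 ∘ near v)) ⟨
      B + (∑[ u < n ] 𝟙 (near v u)) * B    ≤⟨ +-monoʳ-≤ B (*-monoˡ-≤ B (∑near≤[Δ+1]² v)) ⟩
      B + (Δ + 1) * (Δ + 1) * B            ≡⟨ lemma B (Δ + 1) ⟩
      B * (1 + (Δ + 1) * (Δ + 1))          ∎
      where
      open ≤-Reasoning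
      e = Q ^ (2 + d)
      E-N⟦v⟧ = 𝔼 n (𝟙 ∘ fewOutside N⟦ v ⟧)
      E-sep : Fin n → ℕ
      E-sep u = 𝔼 n (𝟙 ∘ fewOutside (sep u v))
      𝔼-threats : 𝔼 n (λ ω → threats ω v) ≡ E-N⟦v⟧ + ∑[ u < n ] (𝟙 (near v u) * E-sep u)
      𝔼-threats = trans (𝔼-+ n _ _) (cong (E-N⟦v⟧ +_) (trans
        (𝔼-∑ n (λ u ω → 𝟙 (near v u) * 𝟙 (fewOutside (sep u v) ω)))
        (sum-cong-≗ λ u → 𝔼-*ˡ n (𝟙 (near v u)) (𝟙 ∘ fewOutside (sep u v)))))
      E-N⟦v⟧≤B : E-N⟦v⟧ * e ≤ B
      E-N⟦v⟧≤B with ≢-witness 2≤n v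
      ... | u , u≢v = 𝔼-fewOutside≤B N⟦ v ⟧ (≤-trans (2+d+t≤∣sep∣ u≢v) (∣p─q∣≤∣p∣ N⟦ v ⟧ N⟦ u ⟧)) (∣N⟦⟧∣≤Δ+1 v)
      near-term≤ : ∀ u → 𝟙 (near v u) * E-sep u * e ≤ 𝟙 (near v u) * B
      near-term≤ u with near v u in near-vu
      ... | false = z≤n
      ... | true = ≤-trans (≤-reflexive (*-assoc 1 (E-sep u) e)) (*-monoʳ-≤ 1
                     (𝔼-fewOutside≤B (sep u v) (2+d+t≤∣sep∣ (near⇒≢ near-vu)) (∣sep∣≤Δ+1 u v)))
      lemma : ∀ B D → B + D * D * B ≡ B * (1 + D * D)
      lemma = solve-∀

    ∃-large-removed : ∃ λ ω → n * j * Q ^ suc d ≤ Q ^ (2 + d) * ∣ removed ω ∣ + n * L * j ^ (2 + d)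
    ∃-large-removed with ∃≥𝔼 n (∣_∣ ∘ removed)
    ... | ω , R≤ = ω , *-cancelˡ-≤ (Q * Q ^ n) {{m*n≢0 Q (Q ^ n) {{Q≢0}} {{m^n≢0 Q n {{Q≢0}}}}}} (begin
      Q * Q ^ n * (n * j * Q ^ suc d)                      ≡⟨ lemma₁ Q (Q ^ n) (Q ^ d) n j ⟩
      Q ^ e * (n * j * Q ^ n)                              ≡⟨ cong (Q ^ e *_) (𝔼-∣∣ n) ⟨
      Q ^ e * (Q * 𝔼 n ∣_∣)                                ≤⟨ *-monoʳ-≤ (Q ^ e) (*-monoʳ-≤ Q mean≤) ⟩
      Q ^ e * (Q * (R + (Δ + 1) * F))                      ≡⟨ lemma₂ (Q ^ e) Q R (Δ + 1) F ⟩
      Q * Q ^ e * R + Q * (Δ + 1) * (F * Q ^ e)            ≤⟨ +-mono-≤ (*-monoʳ-≤ (Q * Q ^ e) R≤) (*-monoʳ-≤ (Q * (Δ + 1)) 𝔼F≤) ⟩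
      Q * Q ^ e * (Q ^ n * s) + Q * (Δ + 1) * (n * (B * (1 + (Δ + 1) * (Δ + 1))))
                                                           ≡⟨ lemma₃ Q (Q ^ e) (Q ^ n) s (Δ + 1) ((Δ + 1) ^ t) (j ^ e) n ⟩
      Q * Q ^ n * (Q ^ e * s + n * L * j ^ e)              ∎)
      where
      open ≤-Reasoning
      e = 2 + d
      s = ∣ removed ω ∣
      R = 𝔼 n (∣_∣ ∘ removed)
      F = 𝔼 n (λ ω → ∑[ v < n ] threats ω v)
      Q≢0 : NonZero Q
      Q≢0 = >-nonZero (≤-trans j≥1 (m≤m+n j k))
      mean≤ : 𝔼 n ∣_∣ ≤ R + (Δ + 1) * F
      mean≤ = begin
        𝔼 n ∣_∣                                          ≤⟨ 𝔼-mono n (λ ω → ≤-trans (∣ω∣≤∣removed∣+[Δ+1]#bad ω)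
                                                              (+-monoʳ-≤ _ (*-monoʳ-≤ (Δ + 1) (∑-mono-≤ (bad≤threats ω))))) ⟩
        𝔼 n (λ ω → ∣ removed ω ∣ + (Δ + 1) * ∑[ v < n ] threats ω v)
                                                         ≡⟨ trans (𝔼-+ n _ _) (cong (R +_) (𝔼-*ˡ n (Δ + 1) _)) ⟩
        R + (Δ + 1) * F                                  ∎
      𝔼F≤ : F * Q ^ e ≤ n * (B * (1 + (Δ + 1) * (Δ + 1)))
      𝔼F≤ = begin
        F * Q ^ e                                        ≡⟨ cong (_* Q ^ e) (𝔼-∑ n (λ v ω → threats ω v)) ⟩
        (∑[ v < n ] 𝔼 n (λ ω → threats ω v)) * Q ^ e     ≡⟨ *-distribʳ-sum (Q ^ e) (λ v → 𝔼 n (λ ω → threats ω v)) ⟩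
        ∑[ v < n ] (𝔼 n (λ ω → threats ω v) * Q ^ e)     ≤⟨ ∑-mono-≤ 𝔼-threats≤ ⟩
        ∑[ v < n ] (B * (1 + (Δ + 1) * (Δ + 1)))         ≡⟨ ∑-const n _ ⟩
        n * (B * (1 + (Δ + 1) * (Δ + 1)))                ∎
      lemma₁ : ∀ Q a b n j → Q * a * (n * j * (Q * b)) ≡ Q * (Q * b) * (n * j * a)
      lemma₁ = solve-∀
      lemma₂ : ∀ a Q R D F → a * (Q * (R + D * F)) ≡ Q * a * R + Q * D * (F * a)
      lemma₂ = solve-∀
      lemma₃ : ∀ Q a b s D P J n →
        Q * a * (b * s) + Q * D * (n * (P * J * b * (1 + D * D))) ≡ Q * b * (a * s + n * (D * P * (1 + D * D)) * J)
      lemma₃ = solve-∀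

upper-bound : ∀ {n} (G : Graph n) t d → StrongNbhd G (suc t + d + 1) → 1 ≤ d → 2 ≤ maxDegree G →
  ∀ θ → (∀ 𝒞 → IsIdCode G (suc t) 𝒞 → θ ≤ ∣ 𝒞 ∣) →
  d ^ d * n ^ d ≤ (n ∸ θ) ^ d * (maxDegree G + 1) ^ (suc t + 2) * (d + 1) ^ (d + 1) * (2 * suc t)
upper-bound {n} G t d strong d≥1 Δ≥2 θ minimal = from-approx (∃-dth-root-approx M d M≥1 d≥1)
  where
  open Neighbourhoods G
  open RandomCode G t d strong
  K = (Δ + 1) ^ (suc t + 2) * (2 * suc t)
  M = suc d * K
  Δ+1≥3 : 3 ≤ Δ + 1
  Δ+1≥3 = +-monoˡ-≤ 1 Δ≥2
  instance
    Δ+1≢0 : NonZero (Δ + 1)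
    Δ+1≢0 = >-nonZero (≤-trans (s≤s z≤n) Δ+1≥3)
  M≥1 : 1 ≤ M
  M≥1 = ≤-trans (*-mono-≤ (m^n>0 (Δ + 1) (suc t + 2)) (>-nonZero⁻¹ (2 * suc t))) (m≤n*m K (suc d))
  from-approx : (∃₂ λ j k → 1 ≤ j × (j + k) ^ d ≤ M * j ^ d × 2 * (M * j ^ d) ≤ 3 * (j + k) ^ d) →
    d ^ d * n ^ d ≤ (n ∸ θ) ^ d * (Δ + 1) ^ (suc t + 2) * (d + 1) ^ (d + 1) * (2 * suc t)
  from-approx (j , k , j≥1 , Q^d≤M*j^d , 2M*j^d≤3Q^d) = from-ω (∃-large-removed j k j≥1 (2≤Δ⇒2≤n Δ≥2))
    where
    open BernoulliSum j k using (Q)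
    from-ω : (∃ λ ω → n * j * Q ^ suc d ≤ Q ^ (2 + d) * ∣ removed ω ∣ + n * L * j ^ (2 + d)) →
      d ^ d * n ^ d ≤ (n ∸ θ) ^ d * (Δ + 1) ^ (suc t + 2) * (d + 1) ^ (d + 1) * (2 * suc t)
    from-ω (ω , mean≤) = begin
      d ^ d * n ^ d                          ≤⟨ dth-power-bound n s j Q d M j≥1 Q^d≤M*j^d
                                                  (survivors-≥ n s j Q d L j≥1 (m≤m+n j k) [d+1]L*j^d≤Q^d mean≤) ⟩
      s ^ d * suc d ^ d * (suc d * (P * R))  ≡⟨ lemma (s ^ d) (suc d ^ d) (suc d) P R ⟩
      s ^ d * P * (suc d * suc d ^ d) * R    ≤⟨ *-monoˡ-≤ R (*-monoˡ-≤ (suc d * suc d ^ d) (*-monoˡ-≤ P (^-monoˡ-≤ d s≤n∸θ))) ⟩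
      (n ∸ θ) ^ d * P * (suc d ^ suc d) * R  ≡⟨ cong (λ x → (n ∸ θ) ^ d * P * x ^ x * R) (+-comm 1 d) ⟩
      (n ∸ θ) ^ d * P * (d + 1) ^ (d + 1) * R ∎
      where
      open ≤-Reasoning
      s = ∣ removed ω ∣
      P = (Δ + 1) ^ (suc t + 2)
      R = 2 * suc t
      s≤n∸θ : s ≤ n ∸ θ
      s≤n∸θ = begin
        s                   ≡⟨ m∸[m∸n]≡n (∣p∣≤n (removed ω)) ⟨
        n ∸ (n ∸ s)         ≡⟨ cong (n ∸_) (∣∁p∣≡n∸∣p∣ (removed ω)) ⟨
        n ∸ ∣ code ω ∣      ≤⟨ ∸-monoʳ-≤ n (minimal (code ω) (code-isIdCode ω)) ⟩
        n ∸ θ               ∎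
      [d+1]L*j^d≤Q^d : suc d * L * j ^ d ≤ Q ^ d
      [d+1]L*j^d≤Q^d = *-cancelˡ-≤ 3 (begin
        3 * (suc d * L * j ^ d)      ≡⟨ lemma′ (suc d) L (j ^ d) ⟩
        suc d * j ^ d * (3 * L)      ≤⟨ *-monoʳ-≤ (suc d * j ^ d) (3[1+D²]D^r≤4rD^[r+2] (Δ + 1) t Δ+1≥3) ⟩
        suc d * j ^ d * (2 * K)      ≡⟨ lemma″ (suc d) K (j ^ d) ⟩
        2 * (M * j ^ d)              ≤⟨ 2M*j^d≤3Q^d ⟩
        3 * Q ^ d                    ∎)
        where
        lemma′ : ∀ a L b → 3 * (a * L * b) ≡ a * b * (3 * L)
        lemma′ = solve-∀
        lemma″ : ∀ a K b → a * b * (2 * K) ≡ 2 * (a * K * b)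
        lemma″ = solve-∀
      lemma : ∀ a b c P R → a * b * (c * (P * R)) ≡ a * P * (c * b) * R
      lemma = solve-∀

theorem1 : (r d n : ℕ) → 1 ≤ r → 1 ≤ d → (G : Graph n) →
    StrongNbhd G (r + d + 1) → 2 ≤ maxDegree G → (θ : ℕ) → IsMinCodeSize G r θ →
    -- lower bound: 1/(Δ+1) ≤ θ/n
    (n ≤ (maxDegree G + 1) * θ)
    -- upper bound θ/n ≤ 1 - c(d,r)/(Δ+1)^((r+2)/d), raised to the d-th power and cleared of denominators
    × (d ^ d * n ^ d ≤ (n ∸ θ) ^ d * (maxDegree G + 1) ^ (r + 2) * (d + 1) ^ (d + 1) * (2 * r))
theorem1 (suc t) d n r≥1 d≥1 G strong Δ≥2 θ ((𝒞 , 𝒞-isIdCode , refl) , minimal) =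
  n≤[Δ+1]∣𝒞∣ (2≤Δ⇒2≤n Δ≥2) 𝒞 r≥1 𝒞-isIdCode ,
  upper-bound G t d strong d≥1 Δ≥2 ∣ 𝒞 ∣ minimal
  where open Neighbourhoods G
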